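{- The functor $I^*:[\mathcal{C},\mathbf{Set}]\to\mathbf{01Sub}$ (defined in the context) is faithful: if $\varphi,\psi:F\to F'$ are natural transformations between functors $F,F':\mathcal{C}\to\mathbf{Set}$ with $I^*\varphi=I^*\psi$, then $\varphi=\psi$.
   Context: Let $\mathbb{A}$ be a countably infinite set of names and $\mathrm{Perm}\,\mathbb{A}$ the group of finite permutations of $\mathbb{A}$ (permutations moving only finitely many names). A nominal set is a set $X$ with an action $(\pi,x)\mapsto \pi\cdot x$ of $\mathrm{Perm}\,\mathbb{A}$ such that every $x\in X$ has a finite support, i.e. a finite $A\subseteq\mathbb{A}$ such that every $\pi$ fixing each element of $A$ satisfies $\pi\cdot x=x$; $\mathrm{supp}\,x$ is the smallest such finite set, and $a\# x$ means $a\notin\mathrm{supp}\,x$. A function $f$ between nominal sets is equivariant if $f(\pi\cdot x)=\pi\cdot f(x)$. Let $2=\{0,1\}$ with trivial action, and $\mathbb{A}$ with action $\pi\cdot a=\pi(a)$. A $01$-substitution operation on a nominal set $X$ is an equivariant function $X\times\mathbb{A}\times 2\to X$, written $(x,a,i)\mapsto x(a:=i)$, such that for all $x\in X$, $a,a'\in\mathbb{A}$, $i,i'\in 2$: (i) $a\# x(a:=i)$; (ii) if $a\# x$ then $x(a:=i)=x$; (iii) if $a\neq a'$ then $x(a:=i)(a':=i')=x(a':=i')(a:=i)$. The category $\mathbf{01Sub}$ has as objects nominal sets equipped with a $01$-substitution operation, and as morphisms $X\to Y$ equivariant functions $f$ with $f(x(a:=i))=(f\,x)(a:=i)$ for all $x,a,i$.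 The category $\mathcal{C}$ has as objects the finite subsets $A\subseteq\mathbb{A}$; a morphism $f\in\mathcal{C}(A,B)$ is a function $f:A\to B+2$ (disjoint union of $B$ and $\{0,1\}$) that is injective on $f^{ -1}B$. The identity on $A$ is $a\mapsto a$, and the composite of $f\in\mathcal{C}(A,B)$ and $g\in\mathcal{C}(B,C)$ is $(g\circ f)(a)=g(f(a))$ if $f(a)\in B$ and $(g\circ f)(a)=f(a)$ if $f(a)\in 2$. $[\mathcal{C},\mathbf{Set}]$ is the category of functors $\mathcal{C}\to\mathbf{Set}$ and natural transformations. For $A\subseteq B$ write $A\hookrightarrow B$ for the morphism $a\mapsto a$; for $\pi\in\mathrm{Perm}\,\mathbb{A}$ write $\pi|_A\in\mathcal{C}(A,\pi A)$ for $a\mapsto\pi(a)$; for $a\in\mathbb{A}$, $i\in 2$ let $f_{A,a,i}\in\mathcal{C}(A,A-\{a\})$ send $a$ to $i$ (if $a\in A$) and every $b\in A-\{a\}$ to $b$. The functor $I^*:[\mathcal{C},\mathbf{Set}]\to\mathbf{01Sub}$: for $F$, $I^*F$ is the set of equivalence classes $[A,x]$ of pairs with $A\in\mathcal{C}$, $x\in F\,A$, where $(A,x)\sim(A',x')$ iff there is a finite $B\supseteq A\cup A'$ with $F(A\hookrightarrow B)\,x=F(A'\hookrightarrow B)\,x'$; the action is $\pi\cdot[A,x]=[\pi A,F(\pi|_A)\,x]$ and the $01$-substitution is $[A,x](a:=i)=[A-\{a\},F(f_{A,a,i})\,x]$. For a natural transformation $\varphi:F\to F'$, $I^*\varphi[A,x]=[A,\varphi_A\,x]$.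 -}

module Defs where

open import Data.Nat using (ℕ; _<_; _≡ᵇ_)
open import Data.Bool using (Bool; T)
open import Data.List using (List)
open import Data.Bool.ListAction using (any)
open import Data.List.Relation.Unary.Linked using (Linked)
open import Data.Product using (Σ; Σ-syntax; _×_; _,_; proj₁)
open import Data.Sum using (_⊎_; inj₁; inj₂)
open import Relation.Binary.PropositionalEquality using (_≡_)

-- Names: 𝔸 = ℕ (a countably infinite set with decidable equality).

-- Objects of 𝒞: finite subsets of 𝔸, represented canonically as
-- strictly increasing lists of names.
record FinSub : Set where
  constructor finSub
  field
    elems  : List ℕ
    sorted : Linked _<_ elems
open FinSub public

_∈ᵇ_ : ℕ → FinSub → Bool
a ∈ᵇ A = any (a ≡ᵇ_) (elems A)

El : FinSub → Set
El A = Σ ℕ (λ a → T (a ∈ᵇ A))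

_⊆_ : FinSub → FinSub → Set
A ⊆ B = ∀ a → T (a ∈ᵇ A) → T (a ∈ᵇ B)

-- Morphisms of 𝒞: functions A → B + 2 injective on the preimage of B.
record Hom (A B : FinSub) : Set where
  constructor mkHom
  field
    fun : El A → El B ⊎ Bool
    inj : ∀ x y u v → fun x ≡ inj₁ u → fun y ≡ inj₁ v →
          proj₁ u ≡ proj₁ v → proj₁ x ≡ proj₁ y
open Hom public

_≈H_ : ∀ {A B} → Hom A B → Hom A B → Set
f ≈H g = ∀ x → fun f x ≡ fun g x

idH : (A : FinSub) → Hom A A
idH A = mkHom inj₁ (λ { x y u v _≡_.refl _≡_.refl e → e })

compFun : ∀ {A B C} → Hom B C → Hom A B → El A → El C ⊎ Bool
compFun g f x with fun f x
... | inj₁ b = fun g b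
... | inj₂ i = inj₂ i

private
  compInj : ∀ {A B C} (g : Hom B C) (f : Hom A B) → ∀ x y u v →
            compFun g f x ≡ inj₁ u → compFun g f y ≡ inj₁ v →
            proj₁ u ≡ proj₁ v → proj₁ x ≡ proj₁ y
  compInj g f x y u v ex ey e with fun f x in fx | fun f y in fy
  compInj g f x y u v ex ey e | inj₁ b | inj₁ b' =
    inj f x y b b' fx fy (inj g b b' u v ex ey e)
  compInj g f x y u v () ey e | inj₂ i | _
  compInj g f x y u v ex () e | inj₁ b | inj₂ i

_∘H_ : ∀ {A B C} → Hom B C → Hom A B → Hom A C
g ∘H f = mkHom (compFun g f) (compInj g f)

incl : ∀ {A B} → A ⊆ B → Hom A B
incl {A} {B} p =
  mkHom (λ { (a , m) → inj₁ (a , p a m) })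
        (λ { x y u v _≡_.refl _≡_.refl e → e })

record Functor : Set₁ where
  field
    obj      : FinSub → Set
    hom      : ∀ {A B} → Hom A B → obj A → obj B
    hom-resp : ∀ {A B} (f g : Hom A B) → f ≈H g → ∀ x → hom f x ≡ hom g x
    hom-id   : ∀ A x → hom (idH A) x ≡ x
    hom-∘    : ∀ {A B C} (g : Hom B C) (f : Hom A B) x →
               hom (g ∘H f) x ≡ hom g (hom f x)
open Functor public

record NatTrans (F G : Functor) : Set where
  field
    η       : ∀ A → obj F A → obj G A
    natural : ∀ {A B} (f : Hom A B) x → η B (hom F f x) ≡ hom G f (η A x)
open NatTrans public

-- Underlying set of I* F, as pairs (A , x) modulo the relation ~
Pair : Functor → Set
Pair F = Σ FinSub (obj F)

Rel∼ : (F : Functor) → Pair F → Pair F → Set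
Rel∼ F (A , x) (A' , x') =
  Σ[ B ∈ FinSub ] Σ[ p ∈ A ⊆ B ] Σ[ p' ∈ A' ⊆ B ]
    hom F (incl {A} {B} p) x ≡ hom F (incl {A'} {B} p') x'

I*map : ∀ {F G} → NatTrans F G → Pair F → Pair G
I*map φ (A , x) = A , η φ A x

I*Eq : ∀ {F G} → NatTrans F G → NatTrans F G → Set
I*Eq {F} {G} φ ψ = ∀ p → Rel∼ G (I*map φ p) (I*map ψ p)

-- Every inclusion A ↪ B in 𝒞 has a retraction B → A + 2 (keep the names of A,
-- send the others to 0), so every functor sends inclusions to split monos,
-- hence to injections. If I*φ = I*ψ then for each x the elements φ_A x and
-- ψ_A x become equal after some inclusion A ↪ B, and therefore are equal.
module Submission where

open import Defs
open import Relation.Binary.PropositionalEquality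
  using (_≡_; refl; sym; trans; cong; module ≡-Reasoning)
open import Data.Bool using (Bool; false)
open import Data.Bool.Properties using (T-irrelevant)
open import Data.Product using (_,_; proj₁)
open import Data.Sum using (_⊎_; inj₁; inj₂)
open import Relation.Nullary using (yes; no; contradiction)
open import Relation.Nullary.Decidable using (T?)

restrictFun : (A B : FinSub) → El B → El A ⊎ Bool
restrictFun A B (b , _) with T? (b ∈ᵇ A)
... | yes b∈A = inj₁ (b , b∈A)
... | no  _   = inj₂ false

restrictFun-name : ∀ A B (b : El B) {a : El A} →
                   restrictFun A B b ≡ inj₁ a → proj₁ a ≡ proj₁ b
restrictFun-name A B (b , _) eq with T? (b ∈ᵇ A)
restrictFun-name A B (b , _) refl | yes _ = refl
restrictFun-name A B (b , _) ()   | no  _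

restrict : (A B : FinSub) → Hom B A
restrict A B = mkHom (restrictFun A B) λ b b' a a' eq eq' a≡a' →
  trans (sym (restrictFun-name A B b eq))
        (trans a≡a' (restrictFun-name A B b' eq'))

restrict∘incl≈id : ∀ {A B} (A⊆B : A ⊆ B) → (restrict A B ∘H incl A⊆B) ≈H idH A
restrict∘incl≈id {A} _ (a , a∈A) with T? (a ∈ᵇ A)
... | yes a∈A′ = cong (λ m → inj₁ (a , m)) (T-irrelevant a∈A′ a∈A)
... | no  a∉A  = contradiction a∈A a∉A

hom-retraction : ∀ (F : Functor) {A B} (r : Hom B A) (s : Hom A B) →
                 (r ∘H s) ≈H idH A → ∀ x → hom F r (hom F s x) ≡ x
hom-retraction F {A} r s r∘s≈id x = begin
  hom F r (hom F s x) ≡⟨ sym (hom-∘ F r s x) ⟩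
  hom F (r ∘H s) x    ≡⟨ hom-resp F _ _ r∘s≈id x ⟩
  hom F (idH A) x     ≡⟨ hom-id F A x ⟩
  x                   ∎
  where open ≡-Reasoning

hom-incl-cancel : ∀ (F : Functor) {A B} (p p′ : A ⊆ B) {x y : obj F A} →
                  hom F (incl p) x ≡ hom F (incl p′) y → x ≡ y
hom-incl-cancel F {A} {B} p p′ {x} {y} eq = begin
  x                                        ≡⟨ sym (retract p x) ⟩
  hom F (restrict A B) (hom F (incl p) x)  ≡⟨ cong (hom F (restrict A B)) eq ⟩
  hom F (restrict A B) (hom F (incl p′) y) ≡⟨ retract p′ y ⟩
  y                                        ∎
  where
    open ≡-Reasoning
    retract : (q : A ⊆ B) (z : obj F A) → hom F (restrict A B) (hom F (incl q) z) ≡ z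
    retract q = hom-retraction F (restrict A B) (incl q) (restrict∘incl≈id {A} {B} q)

lemma2 : ∀ {F G : Functor} (φ ψ : NatTrans F G) → I*Eq φ ψ →
    ∀ A x → η φ A x ≡ η ψ A x
lemma2 {G = G} φ ψ I*φ≡I*ψ A x with I*φ≡I*ψ (A , x)
... | _ , p , p′ , eq = hom-incl-cancel G p p′ eq
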